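{- For every (finite) term $t$ of $\overline{\lambda}$, every context $\Gamma$ and formula $A$: $t\in\mathcal{S}(\Gamma\Rightarrow A)$ iff $\Gamma\vdash t:A$ holds in the (inductive) typing system of $\overline{\lambda}$.
   Context: Formulas are built from atoms by implication $\supset$ (associating to the right); contexts are finite lists of declarations $x:A$ with distinct variables. Finite terms of $\overline{\lambda}$: $t::=\lambda x^A.t\mid x\langle t_1,\dots,t_k\rangle$, with inductive typing: $\Gamma\vdash\lambda x^A.t:A\supset B$ if $\Gamma,x:A\vdash t:B$; $\Gamma\vdash x\langle t_1,\dots,t_k\rangle:p$ ($p$ atom) if $(x:B_1\supset\cdots\supset B_k\supset p)\in\Gamma$ and $\Gamma\vdash t_i:B_i$ for all $i$ (cut-free $\overline{\lambda}$/LJT). Böhm forests and elimination alternatives are generated coinductively by $N::=_{co}\lambda x^A.N\mid E_1+\cdots+E_n$, $E::=_{co}x\langle N_1,\dots,N_k\rangle$ ($n,k\ge0$). The solution space is defined corecursively by $\mathcal{S}(\Gamma\Rightarrow A\supset B)=\lambda x^A.\mathcal{S}(\Gamma,x:A\Rightarrow B)$ ($x$ fresh) and $\mathcal{S}(\Gamma\Rightarrow p)=\sum_{(y:B_1\supset\cdots\supset B_k\supset p)\in\Gamma}y\langle\mathcal{S}(\Gamma\Rightarrow B_1),\dots,\mathcal{S}(\Gamma\Rightarrow B_k)\rangle$ for an atom $p$. Membership of a (possibly infinite) term $M::=_{co}\lambda x^A.M\mid x\langle M_1,\dots,M_k\rangle$ in a Böhm forest is the greatest pair of relations with: $\lambda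 x^A.M\in\lambda x^A.N$ if $M\in N$; $M\in E_1+\cdots+E_n$ if $M\in E_i$ for some $i$; $x\langle M_1,\dots,M_k\rangle\in x\langle N_1,\dots,N_k\rangle$ if $M_i\in N_i$ for all $i$. Finite terms are regarded as particular such terms. -}

module Defs where

open import Level using (0ℓ) renaming (suc to lsuc)
open import Data.Nat using (ℕ; zero; suc; _≟_)
open import Data.List using (List; []; _∷_; map)
open import Data.Maybe using (Maybe; just; nothing)
open import Data.Product using (Σ; _×_; _,_)
open import Data.List.Relation.Unary.Any using (Any)
open import Data.List.Relation.Binary.Pointwise using (Pointwise)
open import Relation.Nullary using (yes; no)
open import Relation.Binary.PropositionalEquality using (_≡_)

infixr 7 _⊃_

data Form : Set where
  atom : ℕ → Form
  _⊃_  : Form → Form → Form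

_⊃*_ : List Form → Form → Form
[]       ⊃* C = C
(B ∷ Bs) ⊃* C = B ⊃ (Bs ⊃* C)

-- Contexts: lists of formulas; variables are de Bruijn indices
-- (index 0 = most recently declared variable = head of the list).
-- Distinctness of variables and freshness are automatic in this representation.
Ctx : Set
Ctx = List Form

lookup : Ctx → ℕ → Maybe Form
lookup []      _       = nothing
lookup (A ∷ Γ) zero    = just A
lookup (A ∷ Γ) (suc x) = lookup Γ x

data Tm : Set where
  lam : Form → Tm → Tm
  app : ℕ → List Tm → Tm

mutual
  data _⊢_∶_ : Ctx → Tm → Form → Set where
    ⊢lam : ∀ {Γ A B t} → (A ∷ Γ) ⊢ t ∶ B → Γ ⊢ lam A t ∶ (A ⊃ B)
    ⊢app : ∀ {Γ x ts Bs p} →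
           lookup Γ x ≡ just (Bs ⊃* atom p) →
           Γ ⊢* ts ∶ Bs →
           Γ ⊢ app x ts ∶ atom p

  data _⊢*_∶_ : Ctx → List Tm → List Form → Set where
    []  : ∀ {Γ} → Γ ⊢* [] ∶ []
    _∷_ : ∀ {Γ t ts B Bs} → Γ ⊢ t ∶ B → Γ ⊢* ts ∶ Bs → Γ ⊢* (t ∷ ts) ∶ (B ∷ Bs)

data TermF (X : Set) : Set where
  lam : Form → X → TermF X
  app : ℕ → List X → TermF X

record TermCoalg : Set₁ where
  field
    State : Set
    out   : State → TermF State

-- one layer of a Böhm forest  N ::=co λ x^A. N | E₁ + ⋯ + Eₙ ,
-- with elimination alternatives  E ::=co x⟨N₁,…,Nₖ⟩
data AltF (X : Set) : Set where
  app : ℕ → List X → AltF X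

data ForestF (X : Set) : Set where
  lam : Form → X → ForestF X
  sum : List (AltF X) → ForestF X

record ForestCoalg : Set₁ where
  field
    State : Set
    out   : State → ForestF State

finiteTerms : TermCoalg
finiteTerms = record { State = Tm ; out = unfold }
  where
  unfold : Tm → TermF Tm
  unfold (lam A t)  = lam A t
  unfold (app x ts) = app x ts

-- Solution space 𝒮(Γ ⇒ A), defined corecursively: the coalgebra with
-- states (Γ , A) standing for 𝒮(Γ ⇒ A) and one-step unfolding
--   𝒮(Γ ⇒ A ⊃ B) = λ x^A. 𝒮(Γ, x:A ⇒ B)
--   𝒮(Γ ⇒ p)     = Σ_{(y : B₁⊃⋯⊃Bₖ⊃p) ∈ Γ} y⟨𝒮(Γ ⇒ B₁), …, 𝒮(Γ ⇒ Bₖ)⟩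
-- (sum taken over the declarations of Γ in context order).

args : Form → List Form
args (atom q) = []
args (A ⊃ B)  = A ∷ args B

target : Form → ℕ
target (atom q) = q
target (A ⊃ B)  = target B

-- alternatives for the declarations in the suffix Δ of Γ, whose first entry
-- is the variable y
alts : Ctx → ℕ → ℕ → Ctx → List (AltF (Ctx × Form))
alts Γ p y []      = []
alts Γ p y (B ∷ Δ) with target B ≟ p
... | yes _ = app y (map (λ C → (Γ , C)) (args B)) ∷ alts Γ p (suc y) Δ
... | no  _ = alts Γ p (suc y) Δ

𝒮-out : Ctx × Form → ForestF (Ctx × Form)
𝒮-out (Γ , A ⊃ B)  = lam A (A ∷ Γ , B)
𝒮-out (Γ , atom p) = sum (alts Γ p 0 Γ)

𝒮-coalg : ForestCoalg
𝒮-coalg = record { State = Ctx × Form ; out = 𝒮-out }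

-- Membership: the greatest relation closed under
--   λx^A.M ∈ λx^A.N        if M ∈ N
--   M ∈ E₁ + ⋯ + Eₙ        if M ∈ Eᵢ for some i
--   x⟨M₁..Mₖ⟩ ∈ x⟨N₁..Nₖ⟩  if Mᵢ ∈ Nᵢ for all i
-- given as the union of all post-fixed points (Knaster–Tarski).

module _ {S T : Set} (R : S → T → Set) where

  data StepA : TermF S → AltF T → Set where
    app : ∀ {x Ms Ns} → Pointwise R Ms Ns → StepA (app x Ms) (app x Ns)

  data Step : TermF S → ForestF T → Set where
    lam : ∀ {A M N} → R M N → Step (lam A M) (lam A N)
    sum : ∀ {M Es} → Any (StepA M) Es → Step M (sum Es)

IsMembershipSim : (C : TermCoalg) (F : ForestCoalg) →
                  (TermCoalg.State C → ForestCoalg.State F → Set) → Set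
IsMembershipSim C F R =
  ∀ M N → R M N → Step R (TermCoalg.out C M) (ForestCoalg.out F N)

Member : (C : TermCoalg) (F : ForestCoalg) →
         TermCoalg.State C → ForestCoalg.State F → Set₁
Member C F M N =
  Σ (TermCoalg.State C → ForestCoalg.State F → Set) λ R →
    IsMembershipSim C F R × R M N

_∈𝒮⟨_⇒_⟩ : Tm → Ctx → Form → Set₁
t ∈𝒮⟨ Γ ⇒ A ⟩ = Member finiteTerms 𝒮-coalg t (Γ , A)

-- A typing derivation of t is itself a membership witness: the relation
-- "Γ ⊢ t ∶ A" between finite terms and states (Γ , A) of the solution space
-- is closed under the membership rules, because an application x⟨ts⟩ typed by
-- the declaration x : B₁ ⊃ ⋯ ⊃ Bₖ ⊃ p is exactly the alternative contributed
-- by x to 𝒮(Γ ⇒ p).  Conversely, any relation closed under the membership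
-- rules relates a finite term only to states at which it is typable, by
-- induction on the term: each unfolding step of 𝒮 is a typing rule read
-- backwards.
module Submission where

open import Defs
open import Function.Bundles using (_⇔_; mk⇔)
open import Data.Nat using (ℕ; zero; suc; _+_; _≟_)
open import Data.Nat.Properties using (+-identityʳ; +-suc)
open import Data.List using ([]; _∷_; map)
open import Data.Maybe using (just)
open import Data.Product using (Σ-syntax; ∃-syntax; _×_; _,_)
open import Data.Sum using (_⊎_; inj₁; inj₂)
open import Data.List.Relation.Unary.Any using (Any; here; there; satisfied)
open import Data.List.Relation.Binary.Pointwise using (Pointwise; []; _∷_)
open import Relation.Nullary using (¬_; yes; no; contradiction)
open import Relation.Binary.PropositionalEquality using (_≡_; refl; sym; trans; cong; subst)

args-⊃* : ∀ Bs p → args (Bs ⊃* atom p) ≡ Bs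
args-⊃* []       p = refl
args-⊃* (B ∷ Bs) p = cong (B ∷_) (args-⊃* Bs p)

target-⊃* : ∀ Bs p → target (Bs ⊃* atom p) ≡ p
target-⊃* []       p = refl
target-⊃* (B ∷ Bs) p = target-⊃* Bs p

args-⊃*-target : ∀ B → args B ⊃* atom (target B) ≡ B
args-⊃*-target (atom q) = refl
args-⊃*-target (A ⊃ B)  = cong (A ⊃_) (args-⊃*-target B)

module _ {P : AltF (Ctx × Form) → Set} (Γ : Ctx) (p y : ℕ) (B : Form) (Δ : Ctx) where

  alts-here : target B ≡ p → P (app y (map (Γ ,_) (args B))) → Any P (alts Γ p y (B ∷ Δ))
  alts-here tB≡p with target B ≟ p
  ... | yes _   = here
  ... | no tB≢p = contradiction tB≡p tB≢p

  alts-there : Any P (alts Γ p (suc y) Δ) → Any P (alts Γ p y (B ∷ Δ))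
  alts-there with target B ≟ p
  ... | yes _ = there
  ... | no _  = λ a → a

  alts-uncons : Any P (alts Γ p y (B ∷ Δ)) →
                (target B ≡ p × P (app y (map (Γ ,_) (args B)))) ⊎ Any P (alts Γ p (suc y) Δ)
  alts-uncons with target B ≟ p
  ... | yes tB≡p = λ { (here a) → inj₁ (tB≡p , a) ; (there a) → inj₂ a }
  ... | no _     = inj₂

module _ {R : Tm → Ctx × Form → Set} (Γ : Ctx) (p : ℕ) where

  alts-complete : ∀ Δ y {x B ts} → lookup Δ x ≡ just B → target B ≡ p →
                  Pointwise R ts (map (Γ ,_) (args B)) →
                  Any (StepA R (app (y + x) ts)) (alts Γ p y Δ)
  alts-complete (B ∷ Δ) y {zero} refl tB≡p rs
    rewrite +-identityʳ y = alts-here Γ p y B Δ tB≡p (app rs)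
  alts-complete (B′ ∷ Δ) y {suc x} Δx≡B tB≡p rs
    rewrite +-suc y x = alts-there Γ p y B′ Δ (alts-complete Δ (suc y) Δx≡B tB≡p rs)

  alts-sound : ∀ Δ y {x ts} → Any (StepA R (app x ts)) (alts Γ p y Δ) →
               ∃[ x′ ] Σ[ B ∈ Form ] x ≡ y + x′ × lookup Δ x′ ≡ just B × target B ≡ p ×
                 Pointwise R ts (map (Γ ,_) (args B))
  alts-sound (B ∷ Δ) y a with alts-uncons Γ p y B Δ a
  ... | inj₁ (tB≡p , app rs) = 0 , B , sym (+-identityʳ y) , refl , tB≡p , rs
  ... | inj₂ a′ with alts-sound Δ (suc y) a′
  ...   | x′ , B′ , x≡ , Δx′≡B′ , tB′≡p , rs =
          suc x′ , B′ , trans x≡ (sym (+-suc y x′)) , Δx′≡B′ , tB′≡p , rs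

Typed : Tm → Ctx × Form → Set
Typed t (Γ , A) = Γ ⊢ t ∶ A

⊢*⇒Pointwise : ∀ {Γ ts Bs} → Γ ⊢* ts ∶ Bs → Pointwise Typed ts (map (Γ ,_) Bs)
⊢*⇒Pointwise []       = []
⊢*⇒Pointwise (d ∷ ds) = d ∷ ⊢*⇒Pointwise ds

Typed-isMembershipSim : IsMembershipSim finiteTerms 𝒮-coalg Typed
Typed-isMembershipSim (lam A t)  (Γ , _) (⊢lam d)                          = lam d
Typed-isMembershipSim (app x ts) (Γ , _) (⊢app {Bs = Bs} {p = p} Γx≡B ds) =
  sum (alts-complete Γ p Γ 0 Γx≡B (target-⊃* Bs p)
        (subst (λ Cs → Pointwise Typed ts (map (Γ ,_) Cs)) (sym (args-⊃* Bs p))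
               (⊢*⇒Pointwise ds)))

module _ (R : Tm → Ctx × Form → Set) (isSim : IsMembershipSim finiteTerms 𝒮-coalg R) where

  lam∉alts : ∀ {A t} Es → ¬ Any (StepA R (lam A t)) Es
  lam∉alts Es a with satisfied a
  ... | _ , ()

  mutual
    sim⇒⊢ : ∀ t Γ A → R t (Γ , A) → Γ ⊢ t ∶ A
    sim⇒⊢ (lam _ t) Γ A r with A | isSim (lam _ t) (Γ , A) r
    ... | atom _ | sum a   = contradiction a (lam∉alts _)
    ... | B ⊃ C  | lam r′  = ⊢lam (sim⇒⊢ t (B ∷ Γ) C r′)
    sim⇒⊢ (app x ts) Γ A r with A | isSim (app x ts) (Γ , A) r
    ... | _ ⊃ _  | ()
    ... | atom p | sum a with alts-sound Γ p Γ 0 a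
    ...   | _ , B , refl , Γx≡B , refl , rs =
            ⊢app (trans Γx≡B (cong just (sym (args-⊃*-target B)))) (sim⇒⊢* ts Γ (args B) rs)

    sim⇒⊢* : ∀ ts Γ Bs → Pointwise R ts (map (Γ ,_) Bs) → Γ ⊢* ts ∶ Bs
    sim⇒⊢* []       Γ []       []       = []
    sim⇒⊢* (t ∷ ts) Γ (B ∷ Bs) (r ∷ rs) = sim⇒⊢ t Γ B r ∷ sim⇒⊢* ts Γ Bs rs

corollary14 : (t : Tm) (Γ : Ctx) (A : Form) → (t ∈𝒮⟨ Γ ⇒ A ⟩) ⇔ (Γ ⊢ t ∶ A)
corollary14 t Γ A = mk⇔ (λ { (R , isSim , r) → sim⇒⊢ R isSim t Γ A r })
                        (λ d → Typed , Typed-isMembershipSim , d)
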